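{- Let $p$ be an odd prime, $a,m\in\mathbb Z_p$ with $m\not\equiv 0\pmod p$ and $a\not\equiv 0,-1\pmod p$. Put $c_k=\binom ak\binom{ -1-a}k\binom{2k}k$. Then $$\sum_{k=0}^{p-1}\frac{c_k}{m^k(2k-1)}\equiv\Big(\frac8m-2\Big)\sum_{k=0}^{p-1}\frac{kc_k}{m^k}-\sum_{k=0}^{p-1}\frac{c_k}{m^k}-\frac{8a(a+1)}m\sum_{k=0}^{p-2}\frac{c_k}{m^k(k+1)}\pmod{p^3}.$$
   Context: $\mathbb Z_p$ denotes the ring of rational numbers whose denominators are not divisible by $p$; congruences are in $\mathbb Z_p$. Generalized binomial coefficients: $\binom a0=1$, $\binom ak=\frac{a(a-1)\cdots(a-k+1)}{k!}$ for $k\ge1$. -}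

module Defs where

open import Data.Nat as ℕ using (ℕ; zero; suc)
open import Data.Nat.Divisibility using (_∣_)
open import Data.Integer using (+_)
open import Data.Rational as ℚ using (ℚ; 0ℚ; 1ℚ; _+_; _-_; _*_; _/_)
open import Data.Rational.Properties using (_≟_)
open import Data.Product using (Σ; _×_)
open import Relation.Nullary using (¬_; yes; no)
open import Relation.Binary.PropositionalEquality using (_≡_)

ℕ→ℚ : ℕ → ℚ
ℕ→ℚ n = + n / 1

InZp : ℕ → ℚ → Set
InZp p x = ¬ (p ∣ ℚ.denominatorℕ x)

CongMod : ℕ → ℚ → ℚ → ℚ → Set
CongMod p x y n = Σ ℚ (λ z → InZp p z × (x - y ≡ n * z))

-- total inverse (1/0 := 0); only used at nonzero arguments in the statement
inv : ℚ → ℚ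
inv x with x ≟ 0ℚ
... | yes _ = 0ℚ
... | no x≢0 = ℚ.1/_ x {{ℚ.≢-nonZero x≢0}}

_÷_ : ℚ → ℚ → ℚ
x ÷ y = x * inv y

infixl 7 _÷_

_^_ : ℚ → ℕ → ℚ
x ^ zero = 1ℚ
x ^ suc k = x * (x ^ k)

falling : ℚ → ℕ → ℚ
falling a zero = 1ℚ
falling a (suc k) = falling a k * (a - ℕ→ℚ k)

binom : ℚ → ℕ → ℚ
binom a k = falling a k ÷ ℕ→ℚ (k ℕ.!)

sumBelow : ℕ → (ℕ → ℚ) → ℚ
sumBelow zero f = 0ℚ
sumBelow (suc n) f = sumBelow n f + f n

{-# OPTIONS --safe #-}
-- The congruence comes from an exact identity. Write t_k = c_k / m^k. The ratio
-- (k+1)³ c_{k+1} = 2(2k+1)(k(k+1) - a(a+1)) c_k turns the (k+1)-st summand of the left side into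
-- the matching combination of right-hand summands plus B(k+1) - B(k), where B(k) = -8k t_k / m,
-- so the two sides differ by exactly B(p-1) = -8(p-1) c_{p-1} / m^p. Each of the three factors of
-- c_{p-1} is divisible by p: its numerator b(b-1)⋯(b-p+2) meets every residue class except that
-- of b+1, and b ≡ -1 is excluded (for b = a by a ≢ -1, for b = -1-a by a ≢ 0, and 2p-2 ≡ -2),
-- while (p-1)! is a unit. Together with m being a unit this gives p³.
module Submission where

open import Defs
open import Data.Nat as ℕ using (ℕ; zero; suc; _!)
import Data.Nat.Properties as ℕP
open import Data.Integer as ℤ using (ℤ; +_)
import Data.Integer.Properties as ℤP
open import Data.Rational as ℚ using (ℚ; 0ℚ; 1ℚ; -_; _+_; _-_; _*_; fromℚᵘ)
import Data.Rational.Properties as ℚP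
open import Data.Rational.Unnormalised as ℚᵘ using (ℚᵘ; mkℚᵘ; *≡*)
import Data.Rational.Unnormalised.Properties as ℚᵘP
open import Data.Rational.Solver using (module +-*-Solver)
open import Relation.Binary.PropositionalEquality
open import Relation.Nullary using (¬_; Dec; yes; no; contradiction)
open import Data.Empty using (⊥-elim)
open import Data.Product using (Σ; _×_; _,_)
open import Data.Sum using (inj₁; inj₂)
open import Data.Nat.Divisibility using (_∣_; divides; ∣-trans; ∣1⇒≡1; ∣⇒≤; _∣?_)
open import Data.Nat.Primality using (Prime; euclidsLemma; prime⇒irreducible; prime⇒nonZero; prime⇒nonTrivial)
open import Data.Nat.Coprimality using (Coprime; coprime-Bézout)
open import Data.Nat.GCD using (module Bézout)
import Data.Integer.Divisibility.Signed as ℤDiv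
import Data.Integer.DivMod as ℤDivMod
import Data.Integer.GCD as ℤGCD
open +-*-Solver

fromℚᵘ-homo-+ : ∀ u v → fromℚᵘ (u ℚᵘ.+ v) ≡ fromℚᵘ u + fromℚᵘ v
fromℚᵘ-homo-+ u v = ℚP.toℚᵘ-injective (ℚᵘP.≃-trans (ℚP.toℚᵘ-fromℚᵘ _) (ℚᵘP.≃-trans
  (ℚᵘP.+-cong (ℚᵘP.≃-sym (ℚP.toℚᵘ-fromℚᵘ u)) (ℚᵘP.≃-sym (ℚP.toℚᵘ-fromℚᵘ v)))
  (ℚᵘP.≃-sym (ℚP.toℚᵘ-homo-+ (fromℚᵘ u) (fromℚᵘ v)))))

fromℚᵘ-homo-* : ∀ u v → fromℚᵘ (u ℚᵘ.* v) ≡ fromℚᵘ u * fromℚᵘ v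
fromℚᵘ-homo-* u v = ℚP.toℚᵘ-injective (ℚᵘP.≃-trans (ℚP.toℚᵘ-fromℚᵘ _) (ℚᵘP.≃-trans
  (ℚᵘP.*-cong (ℚᵘP.≃-sym (ℚP.toℚᵘ-fromℚᵘ u)) (ℚᵘP.≃-sym (ℚP.toℚᵘ-fromℚᵘ v)))
  (ℚᵘP.≃-sym (ℚP.toℚᵘ-homo-* (fromℚᵘ u) (fromℚᵘ v)))))

fromℚᵘ-homo‿- : ∀ u → fromℚᵘ (ℚᵘ.- u) ≡ - fromℚᵘ u
fromℚᵘ-homo‿- u = ℚP.toℚᵘ-injective (ℚᵘP.≃-trans (ℚP.toℚᵘ-fromℚᵘ _) (ℚᵘP.≃-trans
  (ℚᵘP.-‿cong (ℚᵘP.≃-sym (ℚP.toℚᵘ-fromℚᵘ u))) (ℚᵘP.≃-sym (ℚP.toℚᵘ-homo‿- _))))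

ℤ→ℚ : ℤ → ℚ
ℤ→ℚ i = i ℚ./ 1

ℤ→ℚ-homo-+ : ∀ i j → ℤ→ℚ (i ℤ.+ j) ≡ ℤ→ℚ i + ℤ→ℚ j
ℤ→ℚ-homo-+ i j = trans (ℚP.fromℚᵘ-cong {mkℚᵘ (i ℤ.+ j) 0} {mkℚᵘ i 0 ℚᵘ.+ mkℚᵘ j 0} (*≡* eq))
                       (fromℚᵘ-homo-+ (mkℚᵘ i 0) (mkℚᵘ j 0))
  where
  eq : (i ℤ.+ j) ℤ.* + 1 ≡ (i ℤ.* + 1 ℤ.+ j ℤ.* + 1) ℤ.* + 1
  eq rewrite ℤP.*-identityʳ i | ℤP.*-identityʳ j | ℤP.*-identityʳ (i ℤ.+ j) = refl

ℤ→ℚ-homo-* : ∀ i j → ℤ→ℚ (i ℤ.* j) ≡ ℤ→ℚ i * ℤ→ℚ j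
ℤ→ℚ-homo-* i j = trans (ℚP.fromℚᵘ-cong {mkℚᵘ (i ℤ.* j) 0} {mkℚᵘ i 0 ℚᵘ.* mkℚᵘ j 0} (*≡* refl))
                       (fromℚᵘ-homo-* (mkℚᵘ i 0) (mkℚᵘ j 0))

ℤ→ℚ-homo‿- : ∀ i → ℤ→ℚ (ℤ.- i) ≡ - ℤ→ℚ i
ℤ→ℚ-homo‿- i = fromℚᵘ-homo‿- (mkℚᵘ i 0)

ℕ→ℚ-homo-+ : ∀ m n → ℕ→ℚ (m ℕ.+ n) ≡ ℕ→ℚ m + ℕ→ℚ n
ℕ→ℚ-homo-+ m n = trans (cong ℤ→ℚ (sym (ℤP.pos-+ m n))) (ℤ→ℚ-homo-+ (+ m) (+ n))

ℕ→ℚ-homo-* : ∀ m n → ℕ→ℚ (m ℕ.* n) ≡ ℕ→ℚ m * ℕ→ℚ n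
ℕ→ℚ-homo-* m n = trans (cong ℤ→ℚ (ℤP.pos-* m n)) (ℤ→ℚ-homo-* (+ m) (+ n))

ℕ→ℚ-suc : ∀ n → ℕ→ℚ (suc n) ≡ 1ℚ + ℕ→ℚ n
ℕ→ℚ-suc = ℕ→ℚ-homo-+ 1

ℕ→ℚ-2*suc : ∀ n → ℕ→ℚ (2 ℕ.* suc n) ≡ ℕ→ℚ 2 + ℕ→ℚ 2 * ℕ→ℚ n
ℕ→ℚ-2*suc n = trans (cong ℕ→ℚ (ℕP.*-suc 2 n)) (trans (ℕ→ℚ-homo-+ 2 (2 ℕ.* n)) (cong (λ e → ℕ→ℚ 2 + e) (ℕ→ℚ-homo-* 2 n)))

ℕ→ℚ-suc≢0 : ∀ n → ℕ→ℚ (suc n) ≢ 0ℚ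
ℕ→ℚ-suc≢0 n eq with ℚᵘP.≃-trans (ℚᵘP.≃-sym (ℚP.toℚᵘ-fromℚᵘ (mkℚᵘ (+ suc n) 0))) (ℚP.toℚᵘ-cong eq)
... | *≡* ()

fromℚᵘ-*-denominator : ∀ n d → fromℚᵘ (mkℚᵘ n d) * ℕ→ℚ (suc d) ≡ ℤ→ℚ n
fromℚᵘ-*-denominator n d = trans (sym (fromℚᵘ-homo-* (mkℚᵘ n d) (mkℚᵘ (+ suc d) 0)))
  (ℚP.fromℚᵘ-cong {mkℚᵘ n d ℚᵘ.* mkℚᵘ (+ suc d) 0} {mkℚᵘ n 0}
    (*≡* (trans (ℤP.*-identityʳ _) (cong (n ℤ.*_) (cong +_ (sym (ℕP.*-identityʳ (suc d))))))))

fromℚᵘ-*-1/ : ∀ u .{{_ : ℚᵘ.NonZero u}} → fromℚᵘ u * fromℚᵘ (ℚᵘ.1/ u) ≡ 1ℚ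
fromℚᵘ-*-1/ u = trans (sym (fromℚᵘ-homo-* u (ℚᵘ.1/ u))) (ℚP.fromℚᵘ-cong {u ℚᵘ.* ℚᵘ.1/ u} {ℚᵘ.1ℚᵘ} (ℚᵘP.*-inverseʳ u))

ℕ→ℚ-1+*≡* : ∀ a b c d → 1 ℕ.+ a ℕ.* b ≡ c ℕ.* d → 1ℚ + ℕ→ℚ a * ℕ→ℚ b ≡ ℕ→ℚ c * ℕ→ℚ d
ℕ→ℚ-1+*≡* a b c d eq = begin
  1ℚ + ℕ→ℚ a * ℕ→ℚ b       ≡⟨ cong (λ e → 1ℚ + e) (sym (ℕ→ℚ-homo-* a b)) ⟩
  1ℚ + ℕ→ℚ (a ℕ.* b)       ≡⟨ sym (ℕ→ℚ-suc (a ℕ.* b)) ⟩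
  ℕ→ℚ (1 ℕ.+ a ℕ.* b)      ≡⟨ cong ℕ→ℚ eq ⟩
  ℕ→ℚ (c ℕ.* d)            ≡⟨ ℕ→ℚ-homo-* c d ⟩
  ℕ→ℚ c * ℕ→ℚ d            ∎
  where open ≡-Reasoning

inv-inverseʳ : ∀ x → x ≢ 0ℚ → x * inv x ≡ 1ℚ
inv-inverseʳ x x≢0 with x ℚP.≟ 0ℚ
... | yes x≡0 = contradiction x≡0 x≢0
... | no  x≢0 = ℚP.*-inverseʳ x {{ℚ.≢-nonZero x≢0}}

inv-unique : ∀ x y → x * y ≡ 1ℚ → inv x ≡ y
inv-unique x y xy≡1 = begin
  inv x              ≡⟨ solve 1 (λ x⁻¹ → x⁻¹ := x⁻¹ :* con 1ℚ) refl (inv x) ⟩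
  inv x * 1ℚ         ≡⟨ cong (inv x *_) (sym xy≡1) ⟩
  inv x * (x * y)    ≡⟨ solve 3 (λ x⁻¹ x y → x⁻¹ :* (x :* y) := (x :* x⁻¹) :* y) refl (inv x) x y ⟩
  (x * inv x) * y    ≡⟨ cong (_* y) (inv-inverseʳ x x≢0) ⟩
  1ℚ * y             ≡⟨ ℚP.*-identityˡ y ⟩
  y                  ∎
  where
  open ≡-Reasoning
  x≢0 : x ≢ 0ℚ
  x≢0 refl = ℚP.1≢0 (trans (sym xy≡1) (ℚP.*-zeroˡ y))

inv-distrib-* : ∀ x y → inv (x * y) ≡ inv x * inv y
inv-distrib-* x y = by-cases (x ℚP.≟ 0ℚ) (y ℚP.≟ 0ℚ)
  where
  open ≡-Reasoning
  by-cases : Dec (x ≡ 0ℚ) → Dec (y ≡ 0ℚ) → inv (x * y) ≡ inv x * inv y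
  by-cases (yes x≡0) _ = begin
    inv (x * y)      ≡⟨ cong (λ e → inv (e * y)) x≡0 ⟩
    inv (0ℚ * y)     ≡⟨ cong inv (ℚP.*-zeroˡ y) ⟩
    0ℚ               ≡⟨ sym (ℚP.*-zeroˡ (inv y)) ⟩
    inv 0ℚ * inv y   ≡⟨ cong (λ e → inv e * inv y) (sym x≡0) ⟩
    inv x * inv y    ∎
  by-cases (no _) (yes y≡0) = begin
    inv (x * y)      ≡⟨ cong (λ e → inv (x * e)) y≡0 ⟩
    inv (x * 0ℚ)     ≡⟨ cong inv (ℚP.*-zeroʳ x) ⟩
    0ℚ               ≡⟨ sym (ℚP.*-zeroʳ (inv x)) ⟩
    inv x * inv 0ℚ   ≡⟨ cong (λ e → inv x * inv e) (sym y≡0) ⟩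
    inv x * inv y    ∎
  by-cases (no x≢0) (no y≢0) = inv-unique (x * y) (inv x * inv y) (begin
    x * y * (inv x * inv y)      ≡⟨ solve 4 (λ x y x⁻¹ y⁻¹ → x :* y :* (x⁻¹ :* y⁻¹) := (x :* x⁻¹) :* (y :* y⁻¹)) refl x y (inv x) (inv y) ⟩
    (x * inv x) * (y * inv y)    ≡⟨ cong₂ _*_ (inv-inverseʳ x x≢0) (inv-inverseʳ y y≢0) ⟩
    1ℚ * 1ℚ                      ≡⟨ refl ⟩
    1ℚ                           ∎)

÷-* : ∀ x y z → x ÷ (y * z) ≡ x ÷ y ÷ z
÷-* x y z = trans (cong (x *_) (inv-distrib-* y z)) (sym (ℚP.*-assoc x (inv y) (inv z)))

falling-suc : ∀ z k → falling z (suc k) ≡ z * falling (z - 1ℚ) k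
falling-suc z zero = solve 1 (λ z → con 1ℚ :* (z :- con 0ℚ) := z :* con 1ℚ) refl z
falling-suc z (suc k) = begin
  falling z (suc k) * (z - ℕ→ℚ (suc k))          ≡⟨ cong₂ (λ f n → f * (z - n)) (falling-suc z k) (ℕ→ℚ-suc k) ⟩
  z * falling (z - 1ℚ) k * (z - (1ℚ + ℕ→ℚ k))    ≡⟨ solve 3 (λ z f x → z :* f :* (z :- (con 1ℚ :+ x)) := z :* (f :* (z :- con 1ℚ :- x)))
                                                       refl z (falling (z - 1ℚ) k) (ℕ→ℚ k) ⟩
  z * falling (z - 1ℚ) (suc k)                    ∎
  where open ≡-Reasoning

binom-suc-cleared : ∀ y k → binom y (suc k) * ℕ→ℚ (suc k) ≡ falling y (suc k) ÷ ℕ→ℚ (k !)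
binom-suc-cleared y k = begin
  f * inv (ℕ→ℚ (suc k ℕ.* k !)) * n  ≡⟨ cong (λ e → f * e * n) (trans (cong inv (ℕ→ℚ-homo-* (suc k) (k !))) (inv-distrib-* n g)) ⟩
  f * (inv n * inv g) * n             ≡⟨ solve 4 (λ f n n⁻¹ g⁻¹ → f :* (n⁻¹ :* g⁻¹) :* n := f :* g⁻¹ :* (n :* n⁻¹)) refl f n (inv n) (inv g) ⟩
  f * inv g * (n * inv n)             ≡⟨ cong (f * inv g *_) (inv-inverseʳ n (ℕ→ℚ-suc≢0 k)) ⟩
  f * inv g * 1ℚ                      ≡⟨ ℚP.*-identityʳ (f * inv g) ⟩
  f * inv g                           ∎
  where
  open ≡-Reasoning
  f n g : ℚ
  f = falling y (suc k)
  n = ℕ→ℚ (suc k)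
  g = ℕ→ℚ (k !)

binom-suc : ∀ y k → binom y (suc k) * ℕ→ℚ (suc k) ≡ binom y k * (y - ℕ→ℚ k)
binom-suc y k = trans (binom-suc-cleared y k)
  (solve 3 (λ f d g⁻¹ → f :* d :* g⁻¹ := f :* g⁻¹ :* d) refl (falling y k) (y - ℕ→ℚ k) (inv (ℕ→ℚ (k !))))

binom-absorb : ∀ z k → binom z (suc k) * ℕ→ℚ (suc k) ≡ z * binom (z - 1ℚ) k
binom-absorb z k = trans (binom-suc-cleared z k)
  (trans (cong (_÷ ℕ→ℚ (k !)) (falling-suc z k)) (ℚP.*-assoc z (falling (z - 1ℚ) k) (inv (ℕ→ℚ (k !)))))

binom-*-sub : ∀ y k → binom y k * (y - ℕ→ℚ k) ≡ y * binom (y - 1ℚ) k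
binom-*-sub y k = trans (sym (binom-suc y k)) (binom-absorb y k)

binom-central-suc : ∀ k → let z = ℕ→ℚ (2 ℕ.* suc k); y = ℕ→ℚ (suc k) in
  binom z (suc k) * (y * y) ≡ z * (z - 1ℚ) * binom (ℕ→ℚ (2 ℕ.* k)) k
binom-central-suc k = begin
  binom z (suc k) * (y * y)                  ≡⟨ sym (ℚP.*-assoc (binom z (suc k)) y y) ⟩
  binom z (suc k) * y * y                    ≡⟨ cong₂ _*_ (binom-absorb z k) y≡z-1-k ⟩
  z * binom (z - 1ℚ) k * (z - 1ℚ - ℕ→ℚ k)    ≡⟨ ℚP.*-assoc z (binom (z - 1ℚ) k) (z - 1ℚ - ℕ→ℚ k) ⟩
  z * (binom (z - 1ℚ) k * (z - 1ℚ - ℕ→ℚ k))  ≡⟨ cong (z *_) (binom-*-sub (z - 1ℚ) k) ⟩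
  z * ((z - 1ℚ) * binom (z - 1ℚ - 1ℚ) k)     ≡⟨ cong (λ e → z * ((z - 1ℚ) * binom e k)) z-2≡2k ⟩
  z * ((z - 1ℚ) * binom (ℕ→ℚ (2 ℕ.* k)) k)   ≡⟨ sym (ℚP.*-assoc z (z - 1ℚ) _) ⟩
  z * (z - 1ℚ) * binom (ℕ→ℚ (2 ℕ.* k)) k     ∎
  where
  open ≡-Reasoning
  z y : ℚ
  z = ℕ→ℚ (2 ℕ.* suc k)
  y = ℕ→ℚ (suc k)
  y≡z-1-k : y ≡ z - 1ℚ - ℕ→ℚ k
  y≡z-1-k = trans (ℕ→ℚ-suc k) (trans
    (solve 1 (λ x → con 1ℚ :+ x := con (ℕ→ℚ 2) :+ con (ℕ→ℚ 2) :* x :- con 1ℚ :- x) refl (ℕ→ℚ k))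
    (cong (λ e → e - 1ℚ - ℕ→ℚ k) (sym (ℕ→ℚ-2*suc k))))
  z-2≡2k : z - 1ℚ - 1ℚ ≡ ℕ→ℚ (2 ℕ.* k)
  z-2≡2k = trans (cong (λ e → e - 1ℚ - 1ℚ) (ℕ→ℚ-2*suc k)) (trans
    (solve 1 (λ x → con (ℕ→ℚ 2) :+ con (ℕ→ℚ 2) :* x :- con 1ℚ :- con 1ℚ := con (ℕ→ℚ 2) :* x) refl (ℕ→ℚ k))
    (sym (ℕ→ℚ-homo-* 2 k)))

-- Read x = k, y = k+1, z = 2k+2, u = t_{k+1}, v = t_k, w = 1/m, J = 1/y, I = 1/(2k+1).
telescoping-step-algebra : ∀ a x y z u v w J I → y ≡ 1ℚ + x → z ≡ ℕ→ℚ 2 * y →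
  y * J ≡ 1ℚ → (z - 1ℚ) * I ≡ 1ℚ →
  u * (y * y * y * y) ≡ z * (z - 1ℚ) * ((a - x) * (- 1ℚ - a - x)) * (v * w) →
  u * I ≡ (ℕ→ℚ 8 * w - ℕ→ℚ 2) * (y * u) - u - ℕ→ℚ 8 * a * (a + 1ℚ) * w * (v * J)
          + - (ℕ→ℚ 8 * y * u * w) - - (ℕ→ℚ 8 * x * v * w)
telescoping-step-algebra a x y _ u v w J I y≡1+x refl yJ≡1 dI≡1 recurrence = sym (begin
  (ℕ→ℚ 8 * w - ℕ→ℚ 2) * (y * u) - u - ℕ→ℚ 8 * a * (a + 1ℚ) * w * (v * J)
    + - (ℕ→ℚ 8 * y * u * w) - - (ℕ→ℚ 8 * x * v * w)
      ≡⟨ solve 7 (λ a x y u v w J →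
           (con (ℕ→ℚ 8) :* w :- con (ℕ→ℚ 2)) :* (y :* u) :- u :- con (ℕ→ℚ 8) :* a :* (a :+ con 1ℚ) :* w :* (v :* J)
             :+ :- (con (ℕ→ℚ 8) :* y :* u :* w) :- :- (con (ℕ→ℚ 8) :* x :* v :* w)
           := con (ℕ→ℚ 8) :* (v :* w) :* (x :- a :* (a :+ con 1ℚ) :* J) :- (con (ℕ→ℚ 2) :* y :+ con 1ℚ) :* u)
         refl a x y u v w J ⟩
  ℕ→ℚ 8 * (v * w) * (x - a * (a + 1ℚ) * J) - (ℕ→ℚ 2 * y + 1ℚ) * u
      ≡⟨ cong (λ e → ℕ→ℚ 8 * (v * w) * e - (ℕ→ℚ 2 * y + 1ℚ) * u) shift ⟩
  ℕ→ℚ 8 * (v * w) * (q * J) - (ℕ→ℚ 2 * y + 1ℚ) * u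
      ≡⟨ cong (_- (ℕ→ℚ 2 * y + 1ℚ) * u) ratio ⟩
  ℕ→ℚ 4 * (y * y) * (u * I) - (ℕ→ℚ 2 * y + 1ℚ) * u
      ≡⟨ balance ⟩
  u * I ∎)
  where
  open ≡-Reasoning
  q d : ℚ
  q = (a - x) * (- 1ℚ - a - x)
  d = ℕ→ℚ 2 * y - 1ℚ

  shift : x - a * (a + 1ℚ) * J ≡ q * J
  shift = begin
    x - a * (a + 1ℚ) * J             ≡⟨ solve 3 (λ x a J → x :- a :* (a :+ con 1ℚ) :* J := x :* con 1ℚ :- a :* (a :+ con 1ℚ) :* J) refl x a J ⟩
    x * 1ℚ - a * (a + 1ℚ) * J        ≡⟨ cong (λ e → x * e - a * (a + 1ℚ) * J) (sym yJ≡1) ⟩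
    x * (y * J) - a * (a + 1ℚ) * J   ≡⟨ solve 4 (λ x y a J → x :* (y :* J) :- a :* (a :+ con 1ℚ) :* J := (x :* y :- a :* (a :+ con 1ℚ)) :* J) refl x y a J ⟩
    (x * y - a * (a + 1ℚ)) * J       ≡⟨ cong (λ e → (x * e - a * (a + 1ℚ)) * J) y≡1+x ⟩
    (x * (1ℚ + x) - a * (a + 1ℚ)) * J ≡⟨ solve 3 (λ x a J → (x :* (con 1ℚ :+ x) :- a :* (a :+ con 1ℚ)) :* J := (a :- x) :* (:- con 1ℚ :- a :- x) :* J) refl x a J ⟩
    q * J                            ∎

  ratio : ℕ→ℚ 8 * (v * w) * (q * J) ≡ ℕ→ℚ 4 * (y * y) * (u * I)
  ratio = begin
    ℕ→ℚ 8 * (v * w) * (q * J)                        ≡⟨ solve 1 (λ t → t := t :* con 1ℚ :* con 1ℚ) refl (ℕ→ℚ 8 * (v * w) * (q * J)) ⟩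
    ℕ→ℚ 8 * (v * w) * (q * J) * 1ℚ * 1ℚ              ≡⟨ cong₂ (λ s t → ℕ→ℚ 8 * (v * w) * (q * J) * s * t) (sym yJ≡1) (sym dI≡1) ⟩
    ℕ→ℚ 8 * (v * w) * (q * J) * (y * J) * (d * I)    ≡⟨ solve 7 (λ v w q J y I s → con (ℕ→ℚ 8) :* s :* (q :* J) :* (y :* J) :* ((con (ℕ→ℚ 2) :* y :- con 1ℚ) :* I)
                                                          := con (ℕ→ℚ 4) :* J :* J :* I :* (con (ℕ→ℚ 2) :* y :* (con (ℕ→ℚ 2) :* y :- con 1ℚ) :* q :* s))
                                                          refl v w q J y I (v * w) ⟩
    ℕ→ℚ 4 * J * J * I * (ℕ→ℚ 2 * y * d * q * (v * w)) ≡⟨ cong (ℕ→ℚ 4 * J * J * I *_) (sym recurrence) ⟩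
    ℕ→ℚ 4 * J * J * I * (u * (y * y * y * y))          ≡⟨ solve 4 (λ J I u y → con (ℕ→ℚ 4) :* J :* J :* I :* (u :* (y :* y :* y :* y))
                                                          := con (ℕ→ℚ 4) :* (y :* y) :* (u :* I) :* (y :* J) :* (y :* J)) refl J I u y ⟩
    ℕ→ℚ 4 * (y * y) * (u * I) * (y * J) * (y * J)    ≡⟨ cong₂ (λ s t → ℕ→ℚ 4 * (y * y) * (u * I) * s * t) yJ≡1 yJ≡1 ⟩
    ℕ→ℚ 4 * (y * y) * (u * I) * 1ℚ * 1ℚ              ≡⟨ solve 1 (λ t → t :* con 1ℚ :* con 1ℚ := t) refl (ℕ→ℚ 4 * (y * y) * (u * I)) ⟩
    ℕ→ℚ 4 * (y * y) * (u * I)                        ∎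

  -- 4y² = (2y - 1)(2y + 1) + 1
  balance : ℕ→ℚ 4 * (y * y) * (u * I) - (ℕ→ℚ 2 * y + 1ℚ) * u ≡ u * I
  balance = begin
    ℕ→ℚ 4 * (y * y) * (u * I) - (ℕ→ℚ 2 * y + 1ℚ) * u  ≡⟨ solve 3 (λ y u I → con (ℕ→ℚ 4) :* (y :* y) :* (u :* I) :- (con (ℕ→ℚ 2) :* y :+ con 1ℚ) :* u
                                                           := u :* I :+ (con (ℕ→ℚ 2) :* y :+ con 1ℚ) :* u :* ((con (ℕ→ℚ 2) :* y :- con 1ℚ) :* I :- con 1ℚ)) refl y u I ⟩
    u * I + (ℕ→ℚ 2 * y + 1ℚ) * u * (d * I - 1ℚ)       ≡⟨ cong (λ e → u * I + (ℕ→ℚ 2 * y + 1ℚ) * u * (e - 1ℚ)) dI≡1 ⟩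
    u * I + (ℕ→ℚ 2 * y + 1ℚ) * u * (1ℚ - 1ℚ)          ≡⟨ solve 3 (λ u I t → u :* I :+ t :* (con 1ℚ :- con 1ℚ) := u :* I) refl u I ((ℕ→ℚ 2 * y + 1ℚ) * u) ⟩
    u * I                                             ∎

module Telescoping (a m : ℚ) where

  c : ℕ → ℚ
  c k = binom a k * binom (- 1ℚ - a) k * binom (ℕ→ℚ (2 ℕ.* k)) k

  t oddTerm weightedTerm shiftedTerm boundary : ℕ → ℚ
  t k = c k ÷ (m ^ k)
  oddTerm k = c k ÷ (m ^ k * (ℕ→ℚ (2 ℕ.* k) - 1ℚ))
  weightedTerm k = ℕ→ℚ k * c k ÷ (m ^ k)
  shiftedTerm k = c k ÷ (m ^ k * ℕ→ℚ (suc k))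
  boundary k = - (ℕ→ℚ 8 * ℕ→ℚ k * t k * inv m)

  Z W : ℚ
  Z = ℕ→ℚ 8 ÷ m - ℕ→ℚ 2
  W = ℕ→ℚ 8 * a * (a + 1ℚ) ÷ m

  lhs rhs : ℕ → ℚ
  lhs n = sumBelow n oddTerm
  rhs n = Z * sumBelow n weightedTerm - sumBelow n t - W * sumBelow (n ℕ.∸ 1) shiftedTerm

  module _ (k : ℕ) where
    private
      x y z q : ℚ
      x = ℕ→ℚ k
      y = ℕ→ℚ (suc k)
      z = ℕ→ℚ (2 ℕ.* suc k)
      q = (a - x) * (- 1ℚ - a - x)

    c-recurrence : c (suc k) * (y * y * y * y) ≡ z * (z - 1ℚ) * q * c k
    c-recurrence = begin
      A′ * B′ * C′ * (y * y * y * y)          ≡⟨ solve 4 (λ A′ B′ C′ y → A′ :* B′ :* C′ :* (y :* y :* y :* y) := A′ :* y :* (B′ :* y) :* (C′ :* (y :* y))) refl A′ B′ C′ y ⟩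
      A′ * y * (B′ * y) * (C′ * (y * y))      ≡⟨ cong₂ _*_ (cong₂ _*_ (binom-suc a k) (binom-suc (- 1ℚ - a) k)) (binom-central-suc k) ⟩
      A * (a - x) * (B * (- 1ℚ - a - x)) * (z * (z - 1ℚ) * C)
          ≡⟨ solve 8 (λ A B C a b x z d → A :* (a :- x) :* (B :* (b :- x)) :* (z :* d :* C) := z :* d :* ((a :- x) :* (b :- x)) :* (A :* B :* C))
               refl A B C a (- 1ℚ - a) x z (z - 1ℚ) ⟩
      z * (z - 1ℚ) * q * c k                  ∎
      where
      open ≡-Reasoning
      A′ B′ C′ A B C : ℚ
      A′ = binom a (suc k)
      B′ = binom (- 1ℚ - a) (suc k)
      C′ = binom z (suc k)
      A = binom a k
      B = binom (- 1ℚ - a) k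
      C = binom (ℕ→ℚ (2 ℕ.* k)) k

    t-recurrence : t (suc k) * (y * y * y * y) ≡ z * (z - 1ℚ) * q * (t k * inv m)
    t-recurrence = begin
      c (suc k) * inv (m * m ^ k) * y⁴              ≡⟨ cong (λ e → c (suc k) * e * y⁴) (inv-distrib-* m (m ^ k)) ⟩
      c (suc k) * (inv m * inv (m ^ k)) * y⁴        ≡⟨ solve 4 (λ c w P y⁴ → c :* (w :* P) :* y⁴ := c :* y⁴ :* (P :* w)) refl (c (suc k)) (inv m) (inv (m ^ k)) y⁴ ⟩
      c (suc k) * y⁴ * (inv (m ^ k) * inv m)        ≡⟨ cong (_* (inv (m ^ k) * inv m)) c-recurrence ⟩
      z * (z - 1ℚ) * q * c k * (inv (m ^ k) * inv m) ≡⟨ solve 4 (λ r c P w → r :* c :* (P :* w) := r :* (c :* P :* w)) refl (z * (z - 1ℚ) * q) (c k) (inv (m ^ k)) (inv m) ⟩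
      z * (z - 1ℚ) * q * (t k * inv m)              ∎
      where
      open ≡-Reasoning
      y⁴ : ℚ
      y⁴ = y * y * y * y

    telescoping-step : oddTerm (suc k) ≡ Z * weightedTerm (suc k) - t (suc k) - W * shiftedTerm k + boundary (suc k) - boundary k
    telescoping-step = begin
      oddTerm (suc k)  ≡⟨ ÷-* (c (suc k)) (m ^ suc k) (z - 1ℚ) ⟩
      t (suc k) * inv (z - 1ℚ)
        ≡⟨ telescoping-step-algebra a x y z (t (suc k)) (t k) (inv m) (inv y) (inv (z - 1ℚ))
             (ℕ→ℚ-suc k) (ℕ→ℚ-homo-* 2 (suc k)) (inv-inverseʳ y (ℕ→ℚ-suc≢0 k)) (inv-inverseʳ (z - 1ℚ) z-1≢0) t-recurrence ⟩
      Z * (y * t (suc k)) - t (suc k) - W * (t k * inv y) + boundary (suc k) - boundary k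
        ≡⟨ cong₂ (λ s r → Z * s - t (suc k) - W * r + boundary (suc k) - boundary k)
             (sym (ℚP.*-assoc y (c (suc k)) (inv (m ^ suc k)))) (sym (÷-* (c k) (m ^ k) y)) ⟩
      Z * weightedTerm (suc k) - t (suc k) - W * shiftedTerm k + boundary (suc k) - boundary k ∎
      where
      open ≡-Reasoning
      z-1≢0 : z - 1ℚ ≢ 0ℚ
      z-1≢0 = subst (_≢ 0ℚ) (sym z-1≡2k+1) (ℕ→ℚ-suc≢0 (2 ℕ.* k))
        where
        z-1≡2k+1 : z - 1ℚ ≡ ℕ→ℚ (suc (2 ℕ.* k))
        z-1≡2k+1 = begin
          z - 1ℚ                          ≡⟨ cong (_- 1ℚ) (ℕ→ℚ-2*suc k) ⟩
          ℕ→ℚ 2 + ℕ→ℚ 2 * x - 1ℚ          ≡⟨ solve 1 (λ x → con (ℕ→ℚ 2) :+ con (ℕ→ℚ 2) :* x :- con 1ℚ := con 1ℚ :+ con (ℕ→ℚ 2) :* x) refl x ⟩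
          1ℚ + ℕ→ℚ 2 * x                  ≡⟨ cong (λ e → 1ℚ + e) (sym (ℕ→ℚ-homo-* 2 k)) ⟩
          1ℚ + ℕ→ℚ (2 ℕ.* k)              ≡⟨ sym (ℕ→ℚ-suc (2 ℕ.* k)) ⟩
          ℕ→ℚ (suc (2 ℕ.* k))             ∎

  telescoping : ∀ j → lhs (suc j) ≡ rhs (suc j) + boundary j
  telescoping zero = solve 3 (λ Z W w → con (lhs 1) := Z :* con (0ℚ + weightedTerm 0) :- con (0ℚ + t 0) :- W :* con 0ℚ
                                                       :+ :- (con (ℕ→ℚ 8) :* con (ℕ→ℚ 0) :* con (t 0) :* w)) refl Z W (inv m)
  telescoping (suc j) = begin
    lhs (suc j) + oddTerm (suc j)
      ≡⟨ cong₂ _+_ (telescoping j) (telescoping-step j) ⟩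
    rhs (suc j) + boundary j + (Z * weightedTerm (suc j) - t (suc j) - W * shiftedTerm j + boundary (suc j) - boundary j)
      ≡⟨ solve 10 (λ S₁ S₀ S₂ t₁ t₀ t₂ Z W e e′ →
           Z :* S₁ :- S₀ :- W :* S₂ :+ e :+ (Z :* t₁ :- t₀ :- W :* t₂ :+ e′ :- e)
           := Z :* (S₁ :+ t₁) :- (S₀ :+ t₀) :- W :* (S₂ :+ t₂) :+ e′) refl
           (sumBelow (suc j) weightedTerm) (sumBelow (suc j) t) (sumBelow j shiftedTerm)
           (weightedTerm (suc j)) (t (suc j)) (shiftedTerm j) Z W (boundary j) (boundary (suc j)) ⟩
    rhs (suc (suc j)) + boundary (suc j) ∎
    where open ≡-Reasoning

module ℤₚ (p : ℕ) (p-prime : Prime p) where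

  instance
    p-nonZero : ℕ.NonZero p
    p-nonZero = prime⇒nonZero p-prime

  P : ℚ
  P = ℕ→ℚ p

  p∤1 : ¬ p ∣ 1
  p∤1 p∣1 = ℕ.nonTrivial⇒≢1 {{prime⇒nonTrivial p-prime}} (∣1⇒≡1 p∣1)

  p∤* : ∀ {m n} → ¬ p ∣ m → ¬ p ∣ n → ¬ p ∣ m ℕ.* n
  p∤* {m} {n} p∤m p∤n p∣mn with euclidsLemma m n p-prime p∣mn
  ... | inj₁ p∣m = p∤m p∣m
  ... | inj₂ p∣n = p∤n p∣n

  -- Unlike InZp, which looks at the reduced form, this is visibly closed under + and *.
  record Integral (x : ℚ) : Set where
    constructor integral
    field
      representative : ℚᵘ
      p∤denominator : ¬ p ∣ ℚᵘ.↧ₙ representative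
      x≡representative : x ≡ fromℚᵘ representative

  Integral⇒InZp : ∀ {x} → Integral x → InZp p x
  Integral⇒InZp (integral (mkℚᵘ n d) p∤d refl) p∣reduced = p∤d (∣-trans p∣reduced reduced∣d)
    where
    reduced∣d : ℚ.denominatorℕ (n ℚ./ suc d) ∣ suc d
    reduced∣d = divides ℤ.∣ ℤGCD.gcd n (+ suc d) ∣ (trans (sym (cong ℤ.∣_∣ (ℚP.↧-/ n (suc d))))
      (trans (ℤP.abs-* (ℚ.↧ (n ℚ./ suc d)) (ℤGCD.gcd n (+ suc d))) (ℕP.*-comm _ ℤ.∣ ℤGCD.gcd n (+ suc d) ∣)))

  InZp⇒Integral : ∀ {x} → InZp p x → Integral x
  InZp⇒Integral {x@(ℚ.mkℚ n d _)} p∤d = integral (mkℚᵘ n d) p∤d (sym (ℚP.fromℚᵘ-toℚᵘ x))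

  Integral-+ : ∀ {x y} → Integral x → Integral y → Integral (x + y)
  Integral-+ (integral u@(mkℚᵘ _ _) p∤u refl) (integral v@(mkℚᵘ _ _) p∤v refl) =
    integral (u ℚᵘ.+ v) (p∤* p∤u p∤v) (sym (fromℚᵘ-homo-+ u v))

  Integral-* : ∀ {x y} → Integral x → Integral y → Integral (x * y)
  Integral-* (integral u@(mkℚᵘ _ _) p∤u refl) (integral v@(mkℚᵘ _ _) p∤v refl) =
    integral (u ℚᵘ.* v) (p∤* p∤u p∤v) (sym (fromℚᵘ-homo-* u v))

  Integral-neg : ∀ {x} → Integral x → Integral (- x)
  Integral-neg (integral u@(mkℚᵘ _ _) p∤u refl) = integral (ℚᵘ.- u) p∤u (sym (fromℚᵘ-homo‿- u))

  Integral-- : ∀ {x y} → Integral x → Integral y → Integral (x - y)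
  Integral-- x∈ y∈ = Integral-+ x∈ (Integral-neg y∈)

  Integral-ℤ : ∀ i → Integral (ℤ→ℚ i)
  Integral-ℤ i = integral (mkℚᵘ i 0) p∤1 refl

  Integral-ℕ : ∀ n → Integral (ℕ→ℚ n)
  Integral-ℕ n = Integral-ℤ (+ n)

  Integral-falling : ∀ {b} → Integral b → ∀ k → Integral (falling b k)
  Integral-falling b∈ zero = Integral-ℕ 1
  Integral-falling b∈ (suc k) = Integral-* (Integral-falling b∈ k) (Integral-- b∈ (Integral-ℕ k))

  InZp-neg : ∀ {x} → InZp p x → InZp p (- x)
  InZp-neg {x} x∈ = Integral⇒InZp (Integral-neg (InZp⇒Integral {x} x∈))

  infix 4 _∣ℤₚ_

  record _∣ℤₚ_ (n x : ℚ) : Set where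
    constructor multiple
    field
      quotient : ℚ
      quotient-integral : Integral quotient
      equality : x ≡ n * quotient

  ∣ℤₚ-+ : ∀ {n x x′} → n ∣ℤₚ x → n ∣ℤₚ x′ → n ∣ℤₚ (x + x′)
  ∣ℤₚ-+ {n} (multiple y y∈ refl) (multiple y′ y′∈ refl) =
    multiple (y + y′) (Integral-+ y∈ y′∈) (sym (ℚP.*-distribˡ-+ n y y′))

  ∣ℤₚ-* : ∀ {n n′ x x′} → n ∣ℤₚ x → n′ ∣ℤₚ x′ → (n * n′) ∣ℤₚ (x * x′)
  ∣ℤₚ-* {n} {n′} (multiple y y∈ refl) (multiple y′ y′∈ refl) = multiple (y * y′) (Integral-* y∈ y′∈)
    (solve 4 (λ n n′ y y′ → n :* y :* (n′ :* y′) := n :* n′ :* (y :* y′)) refl n n′ y y′)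

  ∣ℤₚ-*ʳ : ∀ {n x y} → n ∣ℤₚ x → Integral y → n ∣ℤₚ (x * y)
  ∣ℤₚ-*ʳ {n} {y = y} (multiple z z∈ refl) y∈ = multiple (z * y) (Integral-* z∈ y∈) (ℚP.*-assoc n z y)

  ∣ℤₚ-*ˡ : ∀ {n x y} → Integral y → n ∣ℤₚ x → n ∣ℤₚ (y * x)
  ∣ℤₚ-*ˡ {n} {x} {y} y∈ n∣x = subst (n ∣ℤₚ_) (ℚP.*-comm x y) (∣ℤₚ-*ʳ {n} n∣x y∈)

  ∣ℤₚ-neg : ∀ {n x} → n ∣ℤₚ x → n ∣ℤₚ (- x)
  ∣ℤₚ-neg {n} (multiple y y∈ refl) = multiple (- y) (Integral-neg y∈) (ℚP.neg-distribʳ-* n y)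

  ∣ℤₚ⇒CongMod : ∀ {n} x y → n ∣ℤₚ (x - y) → CongMod p x y n
  ∣ℤₚ⇒CongMod _ _ (multiple z z∈ eq) = z , Integral⇒InZp z∈ , eq

  Integral-inv-fraction : ∀ n d → ¬ p ∣ ℤ.∣ n ∣ → Integral (inv (fromℚᵘ (mkℚᵘ n d)))
  Integral-inv-fraction (+ zero) d p∤0 = contradiction (divides 0 refl) p∤0
  Integral-inv-fraction n@(+ suc _) d p∤n =
    integral (ℚᵘ.1/ mkℚᵘ n d) p∤n (inv-unique (fromℚᵘ (mkℚᵘ n d)) (fromℚᵘ (ℚᵘ.1/ mkℚᵘ n d)) (fromℚᵘ-*-1/ (mkℚᵘ n d)))
  Integral-inv-fraction n@(ℤ.-[1+ _ ]) d p∤n =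
    integral (ℚᵘ.1/ mkℚᵘ n d) p∤n (inv-unique (fromℚᵘ (mkℚᵘ n d)) (fromℚᵘ (ℚᵘ.1/ mkℚᵘ n d)) (fromℚᵘ-*-1/ (mkℚᵘ n d)))

  Integral-inv : ∀ {x} → Integral x → ¬ CongMod p x 0ℚ P → Integral (inv x)
  Integral-inv (integral (mkℚᵘ n d) p∤d refl) x≢0 with p ∣? ℤ.∣ n ∣
  ... | no p∤n = Integral-inv-fraction n d p∤n
  ... | yes p∣n with ℤDiv.∣ᵤ⇒∣ {+ p} {n} p∣n
  ...   | ℤDiv.divides q refl = contradiction (∣ℤₚ⇒CongMod {P} (fromℚᵘ (mkℚᵘ (q ℤ.* + p) d)) 0ℚ (multiple (fromℚᵘ (mkℚᵘ q d)) (integral (mkℚᵘ q d) p∤d refl) eq)) x≢0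
    where
    eq : fromℚᵘ (mkℚᵘ (q ℤ.* + p) d) - 0ℚ ≡ P * fromℚᵘ (mkℚᵘ q d)
    eq = trans (ℚP.+-identityʳ _) (trans
      (ℚP.fromℚᵘ-cong {mkℚᵘ (q ℤ.* + p) d} {mkℚᵘ (+ p) 0 ℚᵘ.* mkℚᵘ q d}
        (*≡* (cong₂ ℤ._*_ (ℤP.*-comm q (+ p)) (cong +_ (ℕP.*-identityˡ (suc d))))))
      (fromℚᵘ-homo-* (mkℚᵘ (+ p) 0) (mkℚᵘ q d)))

  p∤! : ∀ k → k ℕ.< p → ¬ p ∣ k !
  p∤! zero _ = p∤1
  p∤! (suc k) k<p = p∤* (λ p∣k+1 → ℕP.<⇒≱ k<p (∣⇒≤ p∣k+1)) (p∤! k (ℕP.<-trans (ℕP.n<1+n k) k<p))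

  Integral-inv-! : ∀ k → k ℕ.< p → Integral (inv (ℕ→ℚ (k !)))
  Integral-inv-! k k<p = Integral-inv-fraction (+ (k !)) 0 (p∤! k k<p)

  Integral-inv-^ : ∀ {x} → Integral (inv x) → ∀ k → Integral (inv (x ^ k))
  Integral-inv-^ x⁻¹∈ zero = Integral-ℕ 1
  Integral-inv-^ {x} x⁻¹∈ (suc k) = subst Integral (sym (inv-distrib-* x (x ^ k))) (Integral-* x⁻¹∈ (Integral-inv-^ x⁻¹∈ k))

  coprime-p : ∀ {d} → ¬ p ∣ d → Coprime d p
  coprime-p p∤d (e∣d , e∣p) with prime⇒irreducible p-prime e∣p
  ... | inj₁ e≡1 = e≡1
  ... | inj₂ refl = contradiction e∣d p∤d

  inverse-mod-p : ∀ d → ¬ p ∣ d → Σ ℤ λ e → P ∣ℤₚ (1ℚ - ℕ→ℚ d * ℤ→ℚ e)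
  inverse-mod-p d p∤d with coprime-Bézout (coprime-p p∤d)
  ... | Bézout.+- x y eq = + x , multiple (- ℕ→ℚ y) (Integral-neg (Integral-ℕ y)) (begin
    1ℚ - ℕ→ℚ d * ℕ→ℚ x                ≡⟨ cong (λ e → 1ℚ - e) (trans (ℚP.*-comm (ℕ→ℚ d) (ℕ→ℚ x)) (sym (ℕ→ℚ-1+*≡* y p x d eq))) ⟩
    1ℚ - (1ℚ + ℕ→ℚ y * P)             ≡⟨ solve 2 (λ Y P → con 1ℚ :- (con 1ℚ :+ Y :* P) := P :* (:- Y)) refl (ℕ→ℚ y) P ⟩
    P * - ℕ→ℚ y                       ∎)
    where open ≡-Reasoning
  ... | Bézout.-+ x y eq = ℤ.- + x , multiple (ℕ→ℚ y) (Integral-ℕ y) (begin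
    1ℚ - ℕ→ℚ d * ℤ→ℚ (ℤ.- + x)        ≡⟨ cong (λ e → 1ℚ - ℕ→ℚ d * e) (ℤ→ℚ-homo‿- (+ x)) ⟩
    1ℚ - ℕ→ℚ d * - ℕ→ℚ x              ≡⟨ solve 2 (λ D X → con 1ℚ :- D :* (:- X) := con 1ℚ :+ X :* D) refl (ℕ→ℚ d) (ℕ→ℚ x) ⟩
    1ℚ + ℕ→ℚ x * ℕ→ℚ d                ≡⟨ ℕ→ℚ-1+*≡* x d y p eq ⟩
    ℕ→ℚ y * P                         ≡⟨ ℚP.*-comm (ℕ→ℚ y) P ⟩
    P * ℕ→ℚ y                         ∎)
    where open ≡-Reasoning

  integer-mod-p : ∀ {x} → Integral x → Σ ℤ λ i → P ∣ℤₚ (x - ℤ→ℚ i)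
  integer-mod-p x∈@(integral (mkℚᵘ n d) p∤d refl) = multiply (inverse-mod-p (suc d) p∤d)
    where
    open ≡-Reasoning
    x : ℚ
    x = fromℚᵘ (mkℚᵘ n d)
    multiply : Σ ℤ (λ e → P ∣ℤₚ (1ℚ - ℕ→ℚ (suc d) * ℤ→ℚ e)) → Σ ℤ λ i → P ∣ℤₚ (x - ℤ→ℚ i)
    multiply (e , P∣1-de) = n ℤ.* e , subst (P ∣ℤₚ_) eq (∣ℤₚ-*ˡ x∈ P∣1-de)
      where
      eq : x * (1ℚ - ℕ→ℚ (suc d) * ℤ→ℚ e) ≡ x - ℤ→ℚ (n ℤ.* e)
      eq = begin
        x * (1ℚ - ℕ→ℚ (suc d) * ℤ→ℚ e)   ≡⟨ solve 3 (λ x D E → x :* (con 1ℚ :- D :* E) := x :- x :* D :* E) refl x (ℕ→ℚ (suc d)) (ℤ→ℚ e) ⟩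
        x - x * ℕ→ℚ (suc d) * ℤ→ℚ e      ≡⟨ cong (λ t → x - t * ℤ→ℚ e) (fromℚᵘ-*-denominator n d) ⟩
        x - ℤ→ℚ n * ℤ→ℚ e                ≡⟨ cong (λ t → x - t) (sym (ℤ→ℚ-homo-* n e)) ⟩
        x - ℤ→ℚ (n ℤ.* e)                ∎

  residue-mod-p : ∀ {x} → Integral x → Σ ℕ λ r → r ℕ.< p × P ∣ℤₚ (x - ℕ→ℚ r)
  residue-mod-p {x} x∈ = reduce (integer-mod-p x∈)
    where
    reduce : Σ ℤ (λ i → P ∣ℤₚ (x - ℤ→ℚ i)) → Σ ℕ λ r → r ℕ.< p × P ∣ℤₚ (x - ℕ→ℚ r)
    reduce (i , P∣x-i) = r , ℤDivMod.n%ℕd<d i p , subst (P ∣ℤₚ_) eq (∣ℤₚ-+ P∣x-i (multiple (ℤ→ℚ q) (Integral-ℤ q) (ℚP.*-comm (ℤ→ℚ q) P)))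
      where
      open ≡-Reasoning
      r : ℕ
      q : ℤ
      r = i ℤDivMod.%ℕ p
      q = i ℤDivMod./ℕ p
      eq : x - ℤ→ℚ i + ℤ→ℚ q * P ≡ x - ℕ→ℚ r
      eq = begin
        x - ℤ→ℚ i + ℤ→ℚ q * P                   ≡⟨ cong (λ t → x - ℤ→ℚ t + ℤ→ℚ q * P) (ℤDivMod.a≡a%ℕn+[a/ℕn]*n i p) ⟩
        x - ℤ→ℚ (+ r ℤ.+ q ℤ.* + p) + ℤ→ℚ q * P ≡⟨ cong (λ t → x - t + ℤ→ℚ q * P) (trans (ℤ→ℚ-homo-+ (+ r) (q ℤ.* + p)) (cong (λ t → ℕ→ℚ r + t) (ℤ→ℚ-homo-* q (+ p)))) ⟩
        x - (ℕ→ℚ r + ℤ→ℚ q * P) + ℤ→ℚ q * P     ≡⟨ solve 3 (λ x r t → x :- (r :+ t) :+ t := x :- r) refl x (ℕ→ℚ r) (ℤ→ℚ q * P) ⟩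
        x - ℕ→ℚ r                               ∎

  falling-divisible : ∀ {b} r k → Integral b → r ℕ.< k → P ∣ℤₚ (b - ℕ→ℚ r) → P ∣ℤₚ falling b k
  falling-divisible r (suc k) b∈ r<1+k P∣b-r with ℕP.m<1+n⇒m<n∨m≡n r<1+k
  ... | inj₂ refl = ∣ℤₚ-*ˡ (Integral-falling b∈ r) P∣b-r
  ... | inj₁ r<k = ∣ℤₚ-*ʳ (falling-divisible r k b∈ r<k P∣b-r) (Integral-- b∈ (Integral-ℕ k))

  falling-pred-divisible : ∀ {b} k → p ≡ suc k → Integral b → ¬ CongMod p b (- 1ℚ) P → P ∣ℤₚ falling b k
  falling-pred-divisible {b} k p≡1+k b∈ b≢-1 = from-residue (residue-mod-p b∈)
    where
    from-residue : (Σ ℕ λ r → r ℕ.< p × P ∣ℤₚ (b - ℕ→ℚ r)) → P ∣ℤₚ falling b k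
    from-residue (r , r<p , P∣b-r) with ℕP.m<1+n⇒m<n∨m≡n (subst (r ℕ.<_) p≡1+k r<p)
    ... | inj₁ r<k = falling-divisible r k b∈ r<k P∣b-r
    ... | inj₂ refl = contradiction (∣ℤₚ⇒CongMod {P} b (- 1ℚ) (subst (P ∣ℤₚ_) eq P∣b+1)) b≢-1
      where
      P∣b+1 : P ∣ℤₚ (b - ℕ→ℚ r + P)
      P∣b+1 = ∣ℤₚ-+ P∣b-r (multiple 1ℚ (Integral-ℕ 1) (sym (ℚP.*-identityʳ P)))
      eq : b - ℕ→ℚ r + P ≡ b - - 1ℚ
      eq = trans (cong (λ t → b - ℕ→ℚ r + t) (trans (cong ℕ→ℚ p≡1+k) (ℕ→ℚ-suc r)))
                 (solve 2 (λ b r → b :- r :+ (con 1ℚ :+ r) := b :- (:- con 1ℚ)) refl b (ℕ→ℚ r))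

theorem5p1 : (p : ℕ) → Prime p → ¬ (p ≡ 2) → (a m : ℚ) → InZp p a → InZp p m
    → ¬ CongMod p m 0ℚ (ℕ→ℚ p) → ¬ CongMod p a 0ℚ (ℕ→ℚ p) → ¬ CongMod p a (- 1ℚ) (ℕ→ℚ p)
    → let c : ℕ → ℚ
          c k = binom a k * binom (- 1ℚ - a) k * binom (ℕ→ℚ (2 ℕ.* k)) k
      in CongMod p
           (sumBelow p (λ k → c k ÷ (m ^ k * (ℕ→ℚ (2 ℕ.* k) - 1ℚ))))
           ((ℕ→ℚ 8 ÷ m - ℕ→ℚ 2) * sumBelow p (λ k → ℕ→ℚ k * c k ÷ (m ^ k))
             - sumBelow p (λ k → c k ÷ (m ^ k))
             - ℕ→ℚ 8 * a * (a + 1ℚ) ÷ m * sumBelow (p ℕ.∸ 1) (λ k → c k ÷ (m ^ k * ℕ→ℚ (ℕ.suc k))))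
           (ℕ→ℚ p ^ 3)
theorem5p1 zero p-prime = ⊥-elim (ℕP.n≮0 (ℕ.nonTrivial⇒n>1 0 {{prime⇒nonTrivial p-prime}}))
theorem5p1 (suc zero) p-prime = ⊥-elim (ℕP.n≮n 1 (ℕ.nonTrivial⇒n>1 1 {{prime⇒nonTrivial p-prime}}))
theorem5p1 p@(suc (suc i)) p-prime _ a m a∈ℤₚ m∈ℤₚ m≢0 a≢0 a≢-1 =
  ∣ℤₚ⇒CongMod (lhs p) (rhs p) (subst (ℕ→ℚ p ^ 3 ∣ℤₚ_) (sym lhs-rhs≡boundary) P³∣boundary)
  where
  open ℤₚ p p-prime
  open Telescoping a m
  open ≡-Reasoning
  k : ℕ
  k = suc i

  a∈ : Integral a
  a∈ = InZp⇒Integral {a} a∈ℤₚ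

  m⁻¹∈ : Integral (inv m)
  m⁻¹∈ = Integral-inv (InZp⇒Integral {m} m∈ℤₚ) m≢0

  lhs-rhs≡boundary : lhs p - rhs p ≡ boundary k
  lhs-rhs≡boundary = trans (cong (_- rhs p) (telescoping k)) (solve 2 (λ R e → R :+ e :- R := e) refl (rhs p) (boundary k))

  -1-a≢-1 : ¬ CongMod p (- 1ℚ - a) (- 1ℚ) P
  -1-a≢-1 (z , z∈ , eq) = a≢0 (- z , InZp-neg {z} z∈ , (begin
    a - 0ℚ                  ≡⟨ solve 1 (λ a → a :- con 0ℚ := :- (:- con 1ℚ :- a :- (:- con 1ℚ))) refl a ⟩
    - (- 1ℚ - a - - 1ℚ)     ≡⟨ cong -_ eq ⟩
    - (P * z)               ≡⟨ ℚP.neg-distribʳ-* P z ⟩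
    P * - z                 ∎))

  2k-i≡p : ℕ→ℚ (2 ℕ.* k) - ℕ→ℚ i ≡ P * 1ℚ
  2k-i≡p = begin
    ℕ→ℚ (2 ℕ.* k) - ℕ→ℚ i              ≡⟨ cong (_- ℕ→ℚ i) (ℕ→ℚ-2*suc i) ⟩
    ℕ→ℚ 2 + ℕ→ℚ 2 * ℕ→ℚ i - ℕ→ℚ i      ≡⟨ solve 1 (λ x → con (ℕ→ℚ 2) :+ con (ℕ→ℚ 2) :* x :- x := (con 1ℚ :+ (con 1ℚ :+ x)) :* con 1ℚ) refl (ℕ→ℚ i) ⟩
    (1ℚ + (1ℚ + ℕ→ℚ i)) * 1ℚ          ≡⟨ cong (_* 1ℚ) (sym (trans (ℕ→ℚ-suc k) (cong (λ e → 1ℚ + e) (ℕ→ℚ-suc i)))) ⟩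
    P * 1ℚ                             ∎

  binom-divisible : ∀ {y} → P ∣ℤₚ falling y k → P ∣ℤₚ binom y k
  binom-divisible P∣falling = ∣ℤₚ-*ʳ P∣falling (Integral-inv-! k (ℕP.n<1+n k))

  P³∣c : ℕ→ℚ p ^ 3 ∣ℤₚ c k
  P³∣c = subst (_∣ℤₚ c k) (solve 1 (λ P → P :* P :* P := P :* (P :* (P :* con 1ℚ))) refl P)
    (∣ℤₚ-* (∣ℤₚ-* (binom-divisible (falling-pred-divisible k refl a∈ a≢-1))
                  (binom-divisible (falling-pred-divisible k refl (Integral-- (Integral-neg (Integral-ℕ 1)) a∈) -1-a≢-1)))
           (binom-divisible (falling-divisible i k (Integral-ℕ (2 ℕ.* k)) (ℕP.n<1+n i) (multiple 1ℚ (Integral-ℕ 1) 2k-i≡p))))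

  P³∣boundary : ℕ→ℚ p ^ 3 ∣ℤₚ boundary k
  P³∣boundary = ∣ℤₚ-neg (∣ℤₚ-*ʳ (∣ℤₚ-*ˡ (Integral-* (Integral-ℕ 8) (Integral-ℕ k)) (∣ℤₚ-*ʳ P³∣c (Integral-inv-^ {m} m⁻¹∈ k))) m⁻¹∈)
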